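{- Let $l\ge 2$ and $n\ge l+2$ be integers. For integers $a,b\ge 1$ with $a+b=n-l$, let $P_l(a,b)$ denote the $n$-vertex tree obtained from the path $P_l=v_1v_2\ldots v_l$ by attaching $a$ pendant vertices (leaves) to $v_1$ and $b$ pendant vertices to $v_l$. Then $$\xi^d(P_l(1,n-l-1))<\xi^d(P_l(2,n-l-2))<\cdots<\xi^d\Big(P_l\big(\lfloor\tfrac{n-l}{2}\rfloor,\lceil\tfrac{n-l}{2}\rceil\big)\Big).$$
   Context: All graphs are simple and connected. For a graph $G$ and vertices $u,v$, $d_G(u,v)$ is the distance between $u$ and $v$; $D_G(v)=\sum_{u\in V_G}d_G(u,v)$; the eccentricity $\varepsilon_G(v)$ is the maximum distance from $v$ to any vertex of $G$. The eccentric distance sum of $G$ is $\xi^d(G)=\sum_{v\in V_G}\varepsilon_G(v)D_G(v)$. -}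

module Defs where

open import Data.Nat using (ℕ; zero; suc; _+_; _*_; _∸_; _⊔_; _≡ᵇ_; _<ᵇ_)
open import Data.Bool using (Bool; true; false; _∧_; _∨_; if_then_else_)
open import Data.Fin using (Fin; toℕ)
open import Data.List using (List; foldr; map)
open import Data.Nat.ListAction using (sum)
open import Data.Bool.ListAction using (any)
open import Data.List using () renaming (allFin to finList)

-- A (simple) graph on the vertex set Fin n, given by its Boolean adjacency
-- relation (assumed symmetric and irreflexive for the graphs we build).
Graph : ℕ → Set
Graph n = Fin n → Fin n → Bool

_==_ : ∀ {n} → Fin n → Fin n → Bool
u == v = toℕ u ≡ᵇ toℕ v

ball : ∀ {n} → Graph n → ℕ → Fin n → Fin n → Bool
ball G zero    u v = u == v
ball G (suc k) u v = ball G k u v ∨ any (λ w → ball G k u w ∧ G w v) (finList _)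

search : (ℕ → Bool) → ℕ → ℕ → ℕ
search p start zero       = start
search p start (suc fuel) = if p start then start else search p (suc start) fuel

-- d_G(u,v): the least k such that v is within k steps of u
-- (for a connected graph on n vertices this is found among 0 … n-1).
dist : ∀ {n} → Graph n → Fin n → Fin n → ℕ
dist {n} G u v = search (λ k → ball G k u v) 0 n

D : ∀ {n} → Graph n → Fin n → ℕ
D G v = sum (map (λ u → dist G u v) (finList _))

ecc : ∀ {n} → Graph n → Fin n → ℕ
ecc G v = foldr _⊔_ 0 (map (λ u → dist G v u) (finList _))

EDS : ∀ {n} → Graph n → ℕ
EDS G = sum (map (λ v → ecc G v * D G v) (finList _))

-- Tree P_l(a,b) on vertices 0 … l+a+b-1:
--   0 … l-1          : the path v_1 … v_l (vertex i is v_{i+1}),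
--   l … l+a-1        : the a pendant vertices attached to v_1 (vertex 0),
--   l+a … l+a+b-1    : the b pendant vertices attached to v_l (vertex l-1).
edgeℕ : ℕ → ℕ → ℕ → ℕ → Bool
edgeℕ l a i j =
     ((j ≡ᵇ suc i) ∧ (j <ᵇ l))
  ∨ ((j ≡ᵇ 0) ∧ ((l ∸ 1) <ᵇ i) ∧ (i <ᵇ (l + a)))
  ∨ ((j ≡ᵇ (l ∸ 1)) ∧ ((l + a ∸ 1) <ᵇ i))

Pl : (l a b : ℕ) → Graph (l + a + b)
Pl l a b u v = edgeℕ l a (toℕ u) (toℕ v) ∨ edgeℕ l a (toℕ v) (toℕ u)

-- P_l(a,b) is the blow-up of a path: put the a leaves at v₁ on position 0,
-- vᵢ on position i and the b leaves at v_l on position l + 1; then two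
-- vertices are adjacent iff their positions differ by one.  In such a graph
-- the distance is 0 on the diagonal, 2 between distinct vertices of equal
-- position, and the difference of the positions otherwise.  Summing eccentricities times distance
-- sums region by region gives the closed form
--   ξ^d(P_l(a,b)) = EDS₀(l, a + b) + 2 (l + 1)(l − 1) · a b      (`EDS-Pl`),
-- so for fixed a + b the index grows with a b, which increases when a leaf
-- moves from a side with b ≥ a + 2 leaves to the other (`EDS-shift`).
module Submission where

open import Defs
open import Data.Nat
open import Data.Nat.Properties
open import Data.Bool using (Bool; true; false; T; if_then_else_; _∨_; _∧_)
open import Data.Bool.Properties using (T-∧; T-∨)
open import Data.Unit using (tt)
open import Data.Empty using (⊥-elim)
open import Data.Sum using (_⊎_; inj₁; inj₂)
import Data.Sum as Sum
open import Data.Product using (Σ; _×_; _,_; proj₁; proj₂)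
open import Relation.Nullary using (yes; no; does)
open import Relation.Nullary.Decidable using (dec-true; dec-false)
open import Relation.Binary.PropositionalEquality
open import Function.Bundles using (_⇔_; mk⇔; Equivalence)
open import Data.Fin using (Fin; toℕ; fromℕ<)
import Data.Fin as Fin
open import Data.Fin.Properties using (toℕ-injective; toℕ<n; toℕ-fromℕ<)
open import Data.List using (allFin; map; foldr; tabulate)
open import Data.List.Properties using (map-tabulate)
open import Data.Nat.ListAction using (sum)
open import Function using (id; _∘_)
open import Data.Nat.Tactic.RingSolver using (solve-∀)
open import Data.List.Relation.Unary.Any using (satisfied)
open import Data.List.Relation.Unary.Any.Properties using (any⁺; any⁻)
open import Data.List.Membership.Propositional using (lose)
open import Data.List.Membership.Propositional.Properties using (∈-allFin)

open Equivalence using (to; from)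
open import Algebra.Properties.CommutativeSemigroup +-commutativeSemigroup
  using () renaming (interchange to +-interchange)

search-threshold : (p : ℕ → Bool) (d s f : ℕ) → (∀ k → T (p k) ⇔ d ≤ k) →
                   s ≤ d → d < s + f → search p s f ≡ d
search-threshold p d s zero    spec s≤d d<s =
  ⊥-elim (<⇒≱ d<s (subst (_≤ d) (sym (+-identityʳ s)) s≤d))
search-threshold p d s (suc f) spec s≤d d<s+f with p s in eq
... | true  = ≤-antisym s≤d (to (spec s) (subst T (sym eq) tt))
... | false = search-threshold p d (suc s) f spec s<d (subst (d <_) (+-suc s f) d<s+f)
  where
  s<d : s < d
  s<d = ≤∧≢⇒< s≤d (λ s≡d → subst T eq (from (spec s) (≤-reflexive (sym s≡d))))

module Recognise {n : ℕ} (G : Graph n) (ρ : Fin n → Fin n → ℕ)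
  (ρ-self : ∀ u → ρ u u ≡ 0)
  (ρ-zero : ∀ u v → ρ u v ≡ 0 → u ≡ v)
  (ρ-step-up : ∀ u v w → T (G w v) → ρ u v ≤ suc (ρ u w))
  (ρ-step-down : ∀ u v k → ρ u v ≡ suc k → Σ (Fin n) λ w → T (G w v) × ρ u w ≤ k)
  where

  ball⇒ρ : ∀ k u v → T (ball G k u v) → ρ u v ≤ k
  ball⇒ρ zero    u v t = ≤-reflexive (trans (cong (ρ u) (sym u≡v)) (ρ-self u))
    where
    u≡v : u ≡ v
    u≡v = toℕ-injective (≡ᵇ⇒≡ (toℕ u) (toℕ v) t)
  ball⇒ρ (suc k) u v t with to T-∨ t
  ... | inj₁ within = m≤n⇒m≤1+n (ball⇒ρ k u v within)
  ... | inj₂ step with satisfied (any⁻ _ (allFin n) step)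
  ...   | w , uwv with to T-∧ uwv
  ...     | uw , wv = ≤-trans (ρ-step-up u v w wv) (s≤s (ball⇒ρ k u w uw))

  ρ⇒ball : ∀ k u v → ρ u v ≤ k → T (ball G k u v)
  ρ⇒ball zero    u v ρ≤0 = ≡⇒≡ᵇ (toℕ u) (toℕ v) (cong toℕ (ρ-zero u v (n≤0⇒n≡0 ρ≤0)))
  ρ⇒ball (suc k) u v ρ≤k+1 with ρ u v ≤? k
  ... | yes within = from T-∨ (inj₁ (ρ⇒ball k u v within))
  ... | no outside with ρ-step-down u v k (≤-antisym ρ≤k+1 (≰⇒> outside))
  ...   | w , wv , uw =
    from T-∨ (inj₂ (any⁺ _ (lose (∈-allFin w) (from T-∧ (ρ⇒ball k u w uw , wv)))))

  dist≡ρ : (∀ u v → ρ u v < n) → ∀ u v → dist G u v ≡ ρ u v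
  dist≡ρ ρ<n u v = search-threshold (λ k → ball G k u v) (ρ u v) 0 n
                     (λ k → mk⇔ (ball⇒ρ k u v) (ρ⇒ball k u v)) z≤n (ρ<n u v)

unit-gap : ∀ p q → ∣ p - q ∣ ≡ 1 → q ≡ suc p ⊎ p ≡ suc q
unit-gap zero    q       gap = inj₁ gap
unit-gap (suc p) zero    gap = inj₂ gap
unit-gap (suc p) (suc q) gap = Sum.map (cong suc) (cong suc) (unit-gap p q gap)

gap-suc : ∀ p → ∣ p - suc p ∣ ≡ 1
gap-suc zero    = refl
gap-suc (suc p) = gap-suc p

unit-gap⇒≢ : ∀ {p q} → ∣ p - q ∣ ≡ 1 → p ≢ q
unit-gap⇒≢ {p} gap refl = 0≢1+n (trans (sym (∣n-n∣≡0 p)) gap)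

step-toward : ∀ p r k → ∣ p - r ∣ ≡ suc k →
              Σ ℕ λ q → ∣ q - r ∣ ≡ 1 × ∣ p - q ∣ ≡ k × q ≤ p ⊔ r
step-toward zero    (suc r) k gap = r , gap-suc r , suc-injective gap , n≤1+n r
step-toward (suc p) zero    k gap =
  1 , refl , trans (∣-∣-identityʳ p) (suc-injective gap) , s≤s z≤n
step-toward (suc p) (suc r) k gap with step-toward p r k gap
... | q , qr , pq , q≤ = suc q , qr , pq , s≤s q≤

neighbour : ∀ {L} r → 1 ≤ L → r ≤ L → Σ ℕ λ q → ∣ q - r ∣ ≡ 1 × q ≤ L
neighbour zero    1≤L _   = 1 , refl , 1≤L
neighbour (suc r) _   r<L = r , gap-suc r , <⇒≤ r<L

-- The blow-up of a path: vertices x carry positions `pos x`, and two vertices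
-- are adjacent iff their positions differ by one (each position class is an
-- independent set).
module PathBlowUp (pos : ℕ → ℕ) where

  opaque
    δ : ℕ → ℕ → ℕ
    δ x y = if does (x ≟ y) then 0 else (if does (pos x ≟ pos y) then 2 else ∣ pos x - pos y ∣)

    δ-self : ∀ x → δ x x ≡ 0
    δ-self x rewrite dec-true (x ≟ x) refl = refl

    δ-twin : ∀ {x y} → x ≢ y → pos x ≡ pos y → δ x y ≡ 2
    δ-twin {x} {y} x≢y same rewrite dec-false (x ≟ y) x≢y | dec-true (pos x ≟ pos y) same = refl

    δ-far : ∀ {x y} → pos x ≢ pos y → δ x y ≡ ∣ pos x - pos y ∣
    δ-far {x} {y} apart
      rewrite dec-false (x ≟ y) (λ x≡y → apart (cong pos x≡y)) | dec-false (pos x ≟ pos y) apart = refl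

  δ-zero : ∀ x y → δ x y ≡ 0 → x ≡ y
  δ-zero x y δ≡0 with x ≟ y
  ... | yes x≡y = x≡y
  ... | no x≢y with pos x ≟ pos y
  ...   | yes same = ⊥-elim (1+n≢0 (trans (sym (δ-twin x≢y same)) δ≡0))
  ...   | no apart = ⊥-elim (apart (∣m-n∣≡0⇒m≡n (trans (sym (δ-far apart)) δ≡0)))

  gap≤δ : ∀ x y → ∣ pos x - pos y ∣ ≤ δ x y
  gap≤δ x y with x ≟ y
  ... | yes refl = ≤-reflexive (trans (∣n-n∣≡0 (pos x)) (sym (δ-self x)))
  ... | no x≢y with pos x ≟ pos y
  ...   | yes same = ≤-trans (≤-reflexive (trans (cong (∣_- pos y ∣) same) (∣n-n∣≡0 (pos y)))) z≤n
  ...   | no apart = ≤-reflexive (sym (δ-far apart))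

  δ-step-up : ∀ x y w → ∣ pos w - pos y ∣ ≡ 1 → δ x y ≤ suc (δ x w)
  δ-step-up x y w wy with x ≟ y
  ... | yes refl = ≤-trans (≤-reflexive (δ-self x)) z≤n
  ... | no x≢y with pos x ≟ pos y
  ...   | yes same = ≤-reflexive (trans (δ-twin x≢y same) (cong suc (sym xw)))
    where
    gap-xw : ∣ pos x - pos w ∣ ≡ 1
    gap-xw = trans (cong (∣_- pos w ∣) same) (trans (∣-∣-comm (pos y) (pos w)) wy)
    xw : δ x w ≡ 1
    xw = trans (δ-far (unit-gap⇒≢ gap-xw)) gap-xw
  ...   | no apart = begin
    δ x y                                   ≡⟨ δ-far apart ⟩
    ∣ pos x - pos y ∣                       ≤⟨ ∣-∣-triangle (pos x) (pos w) (pos y) ⟩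
    ∣ pos x - pos w ∣ + ∣ pos w - pos y ∣   ≤⟨ +-monoˡ-≤ _ (gap≤δ x w) ⟩
    δ x w + ∣ pos w - pos y ∣               ≡⟨ cong (δ x w +_) wy ⟩
    δ x w + 1                               ≡⟨ +-comm (δ x w) 1 ⟩
    suc (δ x w)                             ∎
    where open ≤-Reasoning

  -- A graph on Fin n realising the blow-up of the path with positions 0 … L
  -- (all of them occupied, L ≥ 2) has δ as its distance; L < n only ensures
  -- that `dist` searches far enough.
  module Realised {n : ℕ} (G : Graph n) (L : ℕ)
    (adjacent : ∀ u v → T (G u v) ⇔ ∣ pos (toℕ u) - pos (toℕ v) ∣ ≡ 1)
    (bounded : ∀ x → x < n → pos x ≤ L)
    (onto : ∀ p → p ≤ L → Σ ℕ λ x → x < n × pos x ≡ p)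
    (2≤L : 2 ≤ L) (L<n : L < n)
    where

    nearest : ∀ x q → x < n → q ≤ L →
              Σ ℕ λ w → w < n × pos w ≡ q × δ x w ≤ ∣ pos x - q ∣
    nearest x q x<n q≤L with pos x ≟ q
    ... | yes at-q = x , x<n , at-q , ≤-trans (≤-reflexive (δ-self x)) z≤n
    ... | no apart with onto q q≤L
    ...   | w , w<n , at-q =
      w , w<n , at-q , ≤-reflexive (trans (δ-far (λ e → apart (trans e at-q))) (cong (∣ pos x -_∣) at-q))

    δ-step-down : ∀ x y k → x < n → y < n → δ x y ≡ suc k →
                  Σ ℕ λ w → w < n × ∣ pos w - pos y ∣ ≡ 1 × δ x w ≤ k
    δ-step-down x y k x<n y<n δ≡ with x ≟ y
    ... | yes refl = ⊥-elim (0≢1+n (trans (sym (δ-self x)) δ≡))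
    ... | no x≢y with pos x ≟ pos y
    ...   | yes same with neighbour (pos y) (≤-trans (s≤s z≤n) 2≤L) (bounded y y<n)
    ...     | q , qy , q≤L with nearest x q x<n q≤L
    ...       | w , w<n , wq , xw = w , w<n , trans (cong (∣_- pos y ∣) wq) qy , ≤-trans xw (≤-reflexive xq)
      where
      k≡1 : k ≡ 1
      k≡1 = suc-injective (trans (sym δ≡) (δ-twin x≢y same))
      xq : ∣ pos x - q ∣ ≡ k
      xq = trans (cong (∣_- q ∣) same) (trans (∣-∣-comm (pos y) q) (trans qy (sym k≡1)))
    δ-step-down x y k x<n y<n δ≡ | no x≢y | no apart
      with step-toward (pos x) (pos y) k (trans (sym (δ-far apart)) δ≡)
    ... | q , qy , xq , q≤ with nearest x q x<n (≤-trans q≤ (⊔-lub (bounded x x<n) (bounded y y<n)))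
    ...   | w , w<n , wq , xw = w , w<n , trans (cong (∣_- pos y ∣) wq) qy , ≤-trans xw (≤-reflexive xq)

    δ≤L : ∀ x y → x < n → y < n → δ x y ≤ L
    δ≤L x y x<n y<n with x ≟ y
    ... | yes refl = ≤-trans (≤-reflexive (δ-self x)) z≤n
    ... | no x≢y with pos x ≟ pos y
    ...   | yes same = ≤-trans (≤-reflexive (δ-twin x≢y same)) 2≤L
    ...   | no apart = ≤-trans (≤-reflexive (δ-far apart))
                        (≤-trans (∣m-n∣≤m⊔n (pos x) (pos y)) (⊔-lub (bounded x x<n) (bounded y y<n)))

    dist≡δ : ∀ u v → dist G u v ≡ δ (toℕ u) (toℕ v)
    dist≡δ = Recognise.dist≡ρ G (λ u v → δ (toℕ u) (toℕ v))
      (λ u → δ-self (toℕ u))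
      (λ u v δ≡0 → toℕ-injective (δ-zero (toℕ u) (toℕ v) δ≡0))
      (λ u v w wv → δ-step-up (toℕ u) (toℕ v) (toℕ w) (to (adjacent w v) wv))
      step-down
      (λ u v → ≤-<-trans (δ≤L (toℕ u) (toℕ v) (toℕ<n u) (toℕ<n v)) L<n)
      where
      step-down : ∀ u v k → δ (toℕ u) (toℕ v) ≡ suc k →
                  Σ (Fin n) λ w → T (G w v) × δ (toℕ u) (toℕ w) ≤ k
      step-down u v k δ≡ with δ-step-down (toℕ u) (toℕ v) k (toℕ<n u) (toℕ<n v) δ≡
      ... | w , w<n , wv , uw rewrite sym (toℕ-fromℕ< w<n) =
        fromℕ< w<n , from (adjacent (fromℕ< w<n) v) wv , uw

sumBelow : ℕ → (ℕ → ℕ) → ℕ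
sumBelow zero    f = 0
sumBelow (suc n) f = f 0 + sumBelow n (λ i → f (suc i))

maxBelow : ℕ → (ℕ → ℕ) → ℕ
maxBelow zero    f = 0
maxBelow (suc n) f = f 0 ⊔ maxBelow n (λ i → f (suc i))

sum-allFin : ∀ {n} (f : Fin n → ℕ) (h : ℕ → ℕ) → (∀ i → f i ≡ h (toℕ i)) →
             sum (map f (allFin n)) ≡ sumBelow n h
sum-allFin {n} f h f≗h = trans (cong sum (map-tabulate id f)) (go f h f≗h)
  where
  go : ∀ {n} (f : Fin n → ℕ) (h : ℕ → ℕ) → (∀ i → f i ≡ h (toℕ i)) → sum (tabulate f) ≡ sumBelow n h
  go {zero}  f h f≗h = refl
  go {suc n} f h f≗h = cong₂ _+_ (f≗h Fin.zero) (go (f ∘ Fin.suc) (h ∘ suc) (f≗h ∘ Fin.suc))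

max-allFin : ∀ {n} (f : Fin n → ℕ) (h : ℕ → ℕ) → (∀ i → f i ≡ h (toℕ i)) →
             foldr _⊔_ 0 (map f (allFin n)) ≡ maxBelow n h
max-allFin {n} f h f≗h = trans (cong (foldr _⊔_ 0) (map-tabulate id f)) (go f h f≗h)
  where
  go : ∀ {n} (f : Fin n → ℕ) (h : ℕ → ℕ) → (∀ i → f i ≡ h (toℕ i)) → foldr _⊔_ 0 (tabulate f) ≡ maxBelow n h
  go {zero}  f h f≗h = refl
  go {suc n} f h f≗h = cong₂ _⊔_ (f≗h Fin.zero) (go (f ∘ Fin.suc) (h ∘ suc) (f≗h ∘ Fin.suc))

sumBelow-cong : ∀ n {f g} → (∀ i → i < n → f i ≡ g i) → sumBelow n f ≡ sumBelow n g
sumBelow-cong zero    f≗g = refl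
sumBelow-cong (suc n) f≗g = cong₂ _+_ (f≗g 0 z<s) (sumBelow-cong n (λ i i<n → f≗g (suc i) (s<s i<n)))

sumBelow-const : ∀ n c {f} → (∀ i → i < n → f i ≡ c) → sumBelow n f ≡ n * c
sumBelow-const zero    c f≡c = refl
sumBelow-const (suc n) c f≡c = cong₂ _+_ (f≡c 0 z<s) (sumBelow-const n c (λ i i<n → f≡c (suc i) (s<s i<n)))

sumBelow-all-but-one : ∀ n c k {f} → k ≤ n → f k ≡ 0 → (∀ i → i ≤ n → i ≢ k → f i ≡ c) →
                       sumBelow (suc n) f ≡ n * c
sumBelow-all-but-one n       c zero    z≤n     f0≡0 f≡c =
  cong₂ _+_ f0≡0 (sumBelow-const n c (λ i i<n → f≡c (suc i) i<n (λ ())))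
sumBelow-all-but-one (suc n) c (suc k) (s≤s k≤n) fk≡0 f≡c =
  cong₂ _+_ (f≡c 0 z≤n (λ ()))
    (sumBelow-all-but-one n c k k≤n fk≡0 (λ i i≤n i≢k → f≡c (suc i) (s≤s i≤n) (i≢k ∘ suc-injective)))

sumBelow-split : ∀ m n f → sumBelow (m + n) f ≡ sumBelow m f + sumBelow n (λ i → f (m + i))
sumBelow-split zero    n f = refl
sumBelow-split (suc m) n f =
  trans (cong (f 0 +_) (sumBelow-split m n (f ∘ suc))) (sym (+-assoc (f 0) _ _))

sumBelow-+ : ∀ n f g → sumBelow n (λ i → f i + g i) ≡ sumBelow n f + sumBelow n g
sumBelow-+ zero    f g = refl
sumBelow-+ (suc n) f g =
  trans (cong (f 0 + g 0 +_) (sumBelow-+ n (f ∘ suc) (g ∘ suc))) (+-interchange (f 0) (g 0) _ _)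

sumBelow-* : ∀ n c f → sumBelow n (λ i → c * f i) ≡ c * sumBelow n f
sumBelow-* zero    c f = sym (*-zeroʳ c)
sumBelow-* (suc n) c f =
  trans (cong (c * f 0 +_) (sumBelow-* n c (f ∘ suc))) (sym (*-distribˡ-+ c (f 0) _))

sumBelow-last : ∀ n f → sumBelow (suc n) f ≡ sumBelow n f + f n
sumBelow-last zero    f = +-comm (f 0) 0
sumBelow-last (suc n) f = trans (cong (f 0 +_) (sumBelow-last n (f ∘ suc))) (sym (+-assoc (f 0) _ _))

sumBelow-reverse : ∀ n f → sumBelow n f ≡ sumBelow n (λ i → f (n ∸ suc i))
sumBelow-reverse zero    f = refl
sumBelow-reverse (suc n) f =
  trans (sumBelow-last n f) (trans (cong (_+ f n) (sumBelow-reverse n f)) (+-comm _ (f n)))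

maxBelow-attained : ∀ n f c → (∀ i → i < n → f i ≤ c) → (Σ ℕ λ i → i < n × f i ≡ c) →
                    maxBelow n f ≡ c
maxBelow-attained n f c bound (i , i<n , fi≡c) = ≤-antisym (max≤ n f bound) (subst (_≤ maxBelow n f) fi≡c (≤max n f i i<n))
  where
  max≤ : ∀ n f → (∀ i → i < n → f i ≤ c) → maxBelow n f ≤ c
  max≤ zero    f bound = z≤n
  max≤ (suc n) f bound = ⊔-lub (bound 0 z<s) (max≤ n (f ∘ suc) (λ i i<n → bound (suc i) (s<s i<n)))
  ≤max : ∀ n f i → i < n → f i ≤ maxBelow n f
  ≤max (suc n) f zero    _         = m≤m⊔n (f 0) _
  ≤max (suc n) f (suc i) (s<s i<n) = ≤-trans (≤max n (f ∘ suc) i i<n) (m≤n⊔m (f 0) _)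

-- Quantities of P_l(a,b) that depend on the path length l only.  For the
-- path vertex v_{x+1}: its eccentricity and its distance sum within the path.
pathEcc : ℕ → ℕ → ℕ
pathEcc l x = suc x ⊔ (l ∸ x)

pathDist : ℕ → ℕ → ℕ
pathDist l x = sumBelow l (λ j → ∣ j - x ∣)

eccDistPath eccDepth depthSum : ℕ → ℕ
eccDistPath l = sumBelow l (λ x → pathEcc l x * pathDist l x)
eccDepth    l = sumBelow l (λ x → pathEcc l x * suc x)
depthSum    l = sumBelow l suc

eccDepth-reverse : ∀ l → sumBelow l (λ x → pathEcc l x * (l ∸ x)) ≡ eccDepth l
eccDepth-reverse l = trans (sumBelow-reverse l _) (sumBelow-cong l mirror)
  where
  mirror : ∀ i → i < l → pathEcc l (l ∸ suc i) * (l ∸ (l ∸ suc i)) ≡ pathEcc l i * suc i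
  mirror i i<l = cong₂ _*_
    (trans (cong₂ _⊔_ (sym (+-∸-assoc 1 i<l)) (m∸[m∸n]≡n i<l)) (⊔-comm (l ∸ i) (suc i)))
    (m∸[m∸n]≡n i<l)

depthSum-reverse : ∀ l → sumBelow l (λ j → l ∸ j) ≡ depthSum l
depthSum-reverse l = trans (sumBelow-reverse l _) (sumBelow-cong l (λ i i<l → m∸[m∸n]≡n i<l))

path-gap≤pathEcc : ∀ l x j → j < l → ∣ x - j ∣ ≤ pathEcc l x
path-gap≤pathEcc l x j j<l with ∣m-n∣≡[m∸n]∨[n∸m] x j
... | inj₁ e = ≤-trans (≤-reflexive e) (≤-trans (m∸n≤m x j) (≤-trans (n≤1+n x) (m≤m⊔n (suc x) (l ∸ x))))
... | inj₂ e = ≤-trans (≤-reflexive e) (≤-trans (∸-monoˡ-≤ x (<⇒≤ j<l)) (m≤n⊔m (suc x) (l ∸ x)))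

-- The tree P_l(a,b) with l = m + 1, a = a' + 1 and b = b' + 1 is the blow-up
-- of the path with positions 0 … l + 1: the a leaves at v₁ sit at position 0,
-- path vertex vᵢ at position i, and the b leaves at v_l at position l + 1.
module Tree (m a' b' : ℕ) where

  l a b N : ℕ
  l = suc m
  a = suc a'
  b = suc b'
  N = l + a + b

  l<l+a : l < l + a
  l<l+a = m<m+n l z<s

  l+a<N : l + a < N
  l+a<N = m<m+n (l + a) z<s

  l<N : l < N
  l<N = <-trans l<l+a l+a<N

  data Region (x : ℕ) : Set where
    on-path    : x < l → Region x
    start-leaf : l ≤ x → x < l + a → Region x
    end-leaf   : l + a ≤ x → Region x

  region : ∀ x → Region x
  region x with x <? l | x <? l + a
  ... | yes x<l | _        = on-path x<l
  ... | no x≮l  | yes x<la = start-leaf (≮⇒≥ x≮l) x<la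
  ... | no _    | no x≮la  = end-leaf (≮⇒≥ x≮la)

  opaque
    pos : ℕ → ℕ
    pos x = if does (x <? l) then suc x else (if does (x <? l + a) then 0 else suc l)

    pos-path : ∀ {x} → x < l → pos x ≡ suc x
    pos-path {x} x<l rewrite dec-true (x <? l) x<l = refl

    pos-start : ∀ {x} → l ≤ x → x < l + a → pos x ≡ 0
    pos-start {x} l≤x x<la rewrite dec-false (x <? l) (≤⇒≯ l≤x) | dec-true (x <? l + a) x<la = refl

    pos-end : ∀ {x} → l + a ≤ x → pos x ≡ suc l
    pos-end {x} la≤x
      rewrite dec-false (x <? l) (≤⇒≯ (≤-trans (<⇒≤ l<l+a) la≤x)) | dec-false (x <? l + a) (≤⇒≯ la≤x) = refl

  pos≤ : ∀ x → pos x ≤ suc l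
  pos≤ x with region x
  ... | on-path x<l         = ≤-trans (≤-reflexive (pos-path x<l)) (s≤s (<⇒≤ x<l))
  ... | start-leaf l≤x x<la = ≤-trans (≤-reflexive (pos-start l≤x x<la)) z≤n
  ... | end-leaf la≤x       = ≤-reflexive (pos-end la≤x)

  pos-onto : ∀ p → p ≤ suc l → Σ ℕ λ x → x < N × pos x ≡ p
  pos-onto zero    _ = l , l<N , pos-start ≤-refl l<l+a
  pos-onto (suc q) q<l+1 with m≤n⇒m<n∨m≡n (s≤s⁻¹ q<l+1)
  ... | inj₁ q<l  = q , <-trans q<l l<N , pos-path q<l
  ... | inj₂ refl = l + a , l+a<N , pos-end ≤-refl

  data Edge (i j : ℕ) : Set where
    along-path : j ≡ suc i → j < l → Edge i j
    start-edge : j ≡ 0 → m < i → i < l + a → Edge i j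
    end-edge   : j ≡ m → m + a < i → Edge i j

  module Tests (i j : ℕ) where
    path-test start-test end-test : Bool
    path-test  = (j ≡ᵇ suc i) ∧ (j <ᵇ l)
    start-test = (j ≡ᵇ 0) ∧ (m <ᵇ i) ∧ (i <ᵇ l + a)
    end-test   = (j ≡ᵇ m) ∧ (m + a <ᵇ i)

  edge⇒ : ∀ {i j} → T (edgeℕ l a i j) → Edge i j
  edge⇒ {i} {j} t with to T-∨ t
  ... | inj₁ e with to T-∧ e
  ...   | j≡ , j<l = along-path (≡ᵇ⇒≡ j (suc i) j≡) (<ᵇ⇒< j l j<l)
  edge⇒ {i} {j} t | inj₂ t′ with to T-∨ t′
  ... | inj₁ e with to T-∧ e
  ...   | j≡0 , bounds with to T-∧ bounds
  ...     | m<i , i<la = start-edge (≡ᵇ⇒≡ j 0 j≡0) (<ᵇ⇒< m i m<i) (<ᵇ⇒< i (l + a) i<la)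
  edge⇒ {i} {j} t | inj₂ t′ | inj₂ e with to T-∧ e
  ... | j≡m , ma<i = end-edge (≡ᵇ⇒≡ j m j≡m) (<ᵇ⇒< (m + a) i ma<i)

  ⇒edge : ∀ {i j} → Edge i j → T (edgeℕ l a i j)
  ⇒edge {i} {j} (along-path j≡ j<l) =
    from (T-∨ {path-test} {start-test ∨ end-test}) (inj₁ (from T-∧ (≡⇒≡ᵇ j (suc i) j≡ , <⇒<ᵇ j<l)))
    where open Tests i j
  ⇒edge {i} {j} (start-edge j≡0 m<i i<la) =
    from (T-∨ {path-test} {start-test ∨ end-test})
      (inj₂ (from (T-∨ {start-test} {end-test})
        (inj₁ (from T-∧ (≡⇒≡ᵇ j 0 j≡0 , from T-∧ (<⇒<ᵇ m<i , <⇒<ᵇ i<la))))))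
    where open Tests i j
  ⇒edge {i} {j} (end-edge j≡m ma<i) =
    from (T-∨ {path-test} {start-test ∨ end-test})
      (inj₂ (from (T-∨ {start-test} {end-test}) (inj₂ (from T-∧ (≡⇒≡ᵇ j m j≡m , <⇒<ᵇ ma<i)))))
    where open Tests i j

  edge-gap : ∀ {i j} → Edge i j → ∣ pos i - pos j ∣ ≡ 1
  edge-gap {i} (along-path refl j<l)
    rewrite pos-path (≤-trans (n≤1+n (suc i)) j<l) | pos-path j<l = gap-suc i
  edge-gap (start-edge refl m<i i<la) rewrite pos-start m<i i<la | pos-path {0} z<s = refl
  edge-gap (end-edge refl ma<i) rewrite pos-end ma<i | pos-path {m} ≤-refl =
    trans (∣-∣-comm (suc m) m) (gap-suc m)

  posIn : ∀ {x} → Region x → ℕ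
  posIn {x} (on-path _)   = suc x
  posIn (start-leaf _ _) = 0
  posIn (end-leaf _)     = suc l

  pos-region : ∀ {x} (r : Region x) → pos x ≡ posIn r
  pos-region (on-path x<l)         = pos-path x<l
  pos-region (start-leaf l≤x x<la) = pos-start l≤x x<la
  pos-region (end-leaf la≤x)       = pos-end la≤x

  consecutive⇒edge : ∀ {i j} (ri : Region i) (rj : Region j) → posIn rj ≡ suc (posIn ri) →
                     Edge i j ⊎ Edge j i
  consecutive⇒edge (on-path _)           (on-path j<l)      refl = inj₁ (along-path refl j<l)
  consecutive⇒edge (on-path _)           (end-leaf la≤j)    refl = inj₂ (end-edge refl la≤j)
  consecutive⇒edge (start-leaf l≤i i<la) (on-path _)        refl = inj₁ (start-edge refl l≤i i<la)
  consecutive⇒edge (end-leaf _)          (on-path j<l)      refl = ⊥-elim (<⇒≱ j<l (n≤1+n l))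
  consecutive⇒edge (end-leaf _)          (end-leaf _)       e    = ⊥-elim (1+n≢n (sym e))
  consecutive⇒edge (on-path _)           (start-leaf _ _)   ()
  consecutive⇒edge (start-leaf _ _)      (start-leaf _ _)   ()
  consecutive⇒edge (start-leaf _ _)      (end-leaf _)       ()
  consecutive⇒edge (end-leaf _)          (start-leaf _ _)   ()

  G : Graph N
  G = Pl l a b

  adjacent : ∀ u v → T (G u v) ⇔ ∣ pos (toℕ u) - pos (toℕ v) ∣ ≡ 1
  adjacent u v = mk⇔ sound complete
    where
    i j : ℕ
    i = toℕ u
    j = toℕ v
    sound : T (G u v) → ∣ pos i - pos j ∣ ≡ 1
    sound t with to T-∨ t
    ... | inj₁ ij = edge-gap (edge⇒ {i} {j} ij)
    ... | inj₂ ji = trans (∣-∣-comm (pos i) (pos j)) (edge-gap (edge⇒ {j} {i} ji))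
    consecutive : ∀ x y → pos y ≡ suc (pos x) → Edge x y ⊎ Edge y x
    consecutive x y e = consecutive⇒edge (region x) (region y)
      (trans (sym (pos-region (region y))) (trans e (cong suc (pos-region (region x)))))
    complete : ∣ pos i - pos j ∣ ≡ 1 → T (G u v)
    complete gap = orient (Sum.[ consecutive i j , Sum.swap ∘ consecutive j i ] (unit-gap (pos i) (pos j) gap))
      where
      orient : Edge i j ⊎ Edge j i → T (edgeℕ l a i j ∨ edgeℕ l a j i)
      orient = from (T-∨ {edgeℕ l a i j} {edgeℕ l a j i}) ∘ Sum.map ⇒edge ⇒edge

  open PathBlowUp pos using (δ; δ-self; δ-far; δ-twin)
  open PathBlowUp.Realised pos G (suc l) adjacent (λ x _ → pos≤ x) pos-onto (s≤s (s≤s z≤n)) (≤-<-trans l<l+a l+a<N)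
    using (dist≡δ; δ≤L)

  δ-at : ∀ {x y p q} → pos x ≡ p → pos y ≡ q → p ≢ q → δ x y ≡ ∣ p - q ∣
  δ-at px py p≢q = trans (δ-far (λ e → p≢q (trans (sym px) (trans e py)))) (cong₂ ∣_-_∣ px py)

  δ-path-path : ∀ {x y} → x < l → y < l → δ x y ≡ ∣ x - y ∣
  δ-path-path {x} {y} x<l y<l with x ≟ y
  ... | yes refl = trans (δ-self x) (sym (∣n-n∣≡0 x))
  ... | no x≢y   = δ-at (pos-path x<l) (pos-path y<l) (x≢y ∘ suc-injective)

  δ-path-start : ∀ {x y} → x < l → l ≤ y → y < l + a → δ x y ≡ suc x
  δ-path-start x<l l≤y y<la = δ-at (pos-path x<l) (pos-start l≤y y<la) (λ ())

  δ-start-path : ∀ {x y} → l ≤ x → x < l + a → y < l → δ x y ≡ suc y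
  δ-start-path l≤x x<la y<l = δ-at (pos-start l≤x x<la) (pos-path y<l) (λ ())

  δ-path-end : ∀ {x y} → x < l → l + a ≤ y → δ x y ≡ l ∸ x
  δ-path-end x<l la≤y = trans (δ-at (pos-path x<l) (pos-end la≤y) (<⇒≢ x<l ∘ suc-injective))
                              (m≤n⇒∣m-n∣≡n∸m (<⇒≤ x<l))

  δ-end-path : ∀ {x y} → l + a ≤ x → y < l → δ x y ≡ l ∸ y
  δ-end-path la≤x y<l = trans (δ-at (pos-end la≤x) (pos-path y<l) (<⇒≢ y<l ∘ sym ∘ suc-injective))
                              (m≤n⇒∣n-m∣≡n∸m (<⇒≤ y<l))

  δ-start-end : ∀ {x y} → l ≤ x → x < l + a → l + a ≤ y → δ x y ≡ suc l
  δ-start-end l≤x x<la la≤y = δ-at (pos-start l≤x x<la) (pos-end la≤y) (λ ())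

  δ-end-start : ∀ {x y} → l + a ≤ x → l ≤ y → y < l + a → δ x y ≡ suc l
  δ-end-start la≤x l≤y y<la = δ-at (pos-end la≤x) (pos-start l≤y y<la) (λ ())

  δ-start-start : ∀ {x y} → l ≤ x → x < l + a → l ≤ y → y < l + a → x ≢ y → δ x y ≡ 2
  δ-start-start l≤x x<la l≤y y<la x≢y = δ-twin x≢y (trans (pos-start l≤x x<la) (sym (pos-start l≤y y<la)))

  δ-end-end : ∀ {x y} → l + a ≤ x → l + a ≤ y → x ≢ y → δ x y ≡ 2
  δ-end-end la≤x la≤y x≢y = δ-twin x≢y (trans (pos-end la≤x) (sym (pos-end la≤y)))

  ecc′ D′ : ℕ → ℕ
  ecc′ x = maxBelow N (δ x)
  D′   x = sumBelow N (λ y → δ y x)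

  by-region : ∀ h → sumBelow N h ≡ sumBelow l h + sumBelow a (λ i → h (l + i)) + sumBelow b (λ i → h (l + a + i))
  by-region h = trans (sumBelow-split (l + a) b h) (cong (_+ sumBelow b (λ i → h (l + a + i))) (sumBelow-split l a h))

  start-index : ∀ {i} → i < a → l ≤ l + i × l + i < l + a
  start-index {i} i<a = m≤m+n l i , +-monoʳ-< l i<a

  end-index : ∀ i → l + a ≤ l + a + i
  end-index i = m≤m+n (l + a) i

  ecc-path : ∀ x → x < l → ecc′ x ≡ pathEcc l x
  ecc-path x x<l = maxBelow-attained N (δ x) _ (λ y _ → bound y) farthest
    where
    bound : ∀ y → δ x y ≤ pathEcc l x
    bound y with region y
    ... | on-path y<l         = ≤-trans (≤-reflexive (δ-path-path x<l y<l)) (path-gap≤pathEcc l x y y<l)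
    ... | start-leaf l≤y y<la = ≤-trans (≤-reflexive (δ-path-start x<l l≤y y<la)) (m≤m⊔n (suc x) (l ∸ x))
    ... | end-leaf la≤y       = ≤-trans (≤-reflexive (δ-path-end x<l la≤y)) (m≤n⊔m (suc x) (l ∸ x))
    farthest : Σ ℕ λ y → y < N × δ x y ≡ pathEcc l x
    farthest with ⊔-sel (suc x) (l ∸ x)
    ... | inj₁ e = l , l<N , trans (δ-path-start x<l ≤-refl l<l+a) (sym e)
    ... | inj₂ e = l + a , l+a<N , trans (δ-path-end x<l ≤-refl) (sym e)

  ecc-start : ∀ x → l ≤ x → x < l + a → ecc′ x ≡ suc l
  ecc-start x l≤x x<la = maxBelow-attained N (δ x) (suc l) (λ y y<N → δ≤L x y (<-trans x<la l+a<N) y<N)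
                           (l + a , l+a<N , δ-start-end l≤x x<la ≤-refl)

  ecc-end : ∀ x → l + a ≤ x → x < N → ecc′ x ≡ suc l
  ecc-end x la≤x x<N = maxBelow-attained N (δ x) (suc l) (λ y y<N → δ≤L x y x<N y<N)
                         (l , l<N , δ-end-start la≤x ≤-refl l<l+a)

  D-path : ∀ x → x < l → D′ x ≡ pathDist l x + a * suc x + b * (l ∸ x)
  D-path x x<l = trans (by-region (λ y → δ y x)) (cong₂ _+_ (cong₂ _+_
    (sumBelow-cong l (λ y y<l → δ-path-path y<l x<l))
    (sumBelow-const a (suc x) (λ i i<a → let (l≤ , <la) = start-index i<a in δ-start-path l≤ <la x<l)))
    (sumBelow-const b (l ∸ x) (λ i _ → δ-end-path (end-index i) x<l)))

  D-start : ∀ k → k < a → D′ (l + k) ≡ depthSum l + a' * 2 + b * suc l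
  D-start k k<a = trans (by-region (λ y → δ y (l + k))) (cong₂ _+_ (cong₂ _+_
    (sumBelow-cong l (λ y y<l → δ-path-start y<l l≤k <la))
    (sumBelow-all-but-one a' 2 k (s≤s⁻¹ k<a) (δ-self (l + k)) twins))
    (sumBelow-const b (suc l) (λ i _ → δ-end-start (end-index i) l≤k <la)))
    where
    l≤k : l ≤ l + k
    l≤k = proj₁ (start-index k<a)
    <la : l + k < l + a
    <la = proj₂ (start-index k<a)
    twins : ∀ i → i ≤ a' → i ≢ k → δ (l + i) (l + k) ≡ 2
    twins i i≤a' i≢k = let (l≤i , i<la) = start-index (s≤s i≤a') in
      δ-start-start l≤i i<la l≤k <la (i≢k ∘ +-cancelˡ-≡ l i k)

  D-end : ∀ k → k < b → D′ (l + a + k) ≡ depthSum l + a * suc l + b' * 2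
  D-end k k<b = trans (by-region (λ y → δ y (l + a + k))) (cong₂ _+_ (cong₂ _+_
    (trans (sumBelow-cong l (λ y y<l → δ-path-end y<l (end-index k))) (depthSum-reverse l))
    (sumBelow-const a (suc l) (λ i i<a → let (l≤i , i<la) = start-index i<a in δ-start-end l≤i i<la (end-index k))))
    (sumBelow-all-but-one b' 2 k (s≤s⁻¹ k<b) (δ-self (l + a + k)) twins))
    where
    twins : ∀ i → i ≤ b' → i ≢ k → δ (l + a + i) (l + a + k) ≡ 2
    twins i _ i≢k = δ-end-end (end-index i) (end-index k) (i≢k ∘ +-cancelˡ-≡ (l + a) i k)

  path-part : sumBelow l (λ x → ecc′ x * D′ x) ≡ eccDistPath l + a * eccDepth l + b * eccDepth l
  path-part = begin
    sumBelow l (λ x → ecc′ x * D′ x)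
      ≡⟨ sumBelow-cong l (λ x x<l → trans (cong₂ _*_ (ecc-path x x<l) (D-path x x<l)) (distribute (e x) (pathDist l x) a (suc x) b (l ∸ x))) ⟩
    sumBelow l (λ x → e x * pathDist l x + a * (e x * suc x) + b * (e x * (l ∸ x)))
      ≡⟨ sumBelow-+ l (λ x → e x * pathDist l x + a * (e x * suc x)) (λ x → b * (e x * (l ∸ x))) ⟩
    sumBelow l (λ x → e x * pathDist l x + a * (e x * suc x)) + sumBelow l (λ x → b * (e x * (l ∸ x)))
      ≡⟨ cong₂ _+_ (trans (sumBelow-+ l (λ x → e x * pathDist l x) (λ x → a * (e x * suc x)))
                          (cong (eccDistPath l +_) (sumBelow-* l a (λ x → e x * suc x))))
                   (sumBelow-* l b (λ x → e x * (l ∸ x))) ⟩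
    eccDistPath l + a * eccDepth l + b * sumBelow l (λ x → e x * (l ∸ x))
      ≡⟨ cong (λ s → eccDistPath l + a * eccDepth l + b * s) (eccDepth-reverse l) ⟩
    eccDistPath l + a * eccDepth l + b * eccDepth l ∎
    where
    open ≡-Reasoning
    e : ℕ → ℕ
    e = pathEcc l
    distribute : ∀ e p a s b t → e * (p + a * s + b * t) ≡ e * p + a * (e * s) + b * (e * t)
    distribute = solve-∀

  EDS-regions : EDS G ≡ eccDistPath l + a * eccDepth l + b * eccDepth l
                        + a * (suc l * (depthSum l + a' * 2 + b * suc l))
                        + b * (suc l * (depthSum l + a * suc l + b' * 2))
  EDS-regions = begin
    EDS G
      ≡⟨ sum-allFin _ (λ x → ecc′ x * D′ x) (λ v → cong₂ _*_
           (max-allFin _ (δ (toℕ v)) (λ u → dist≡δ v u)) (sum-allFin _ (λ y → δ y (toℕ v)) (λ u → dist≡δ u v))) ⟩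
    sumBelow N (λ x → ecc′ x * D′ x)
      ≡⟨ by-region (λ x → ecc′ x * D′ x) ⟩
    sumBelow l (λ x → ecc′ x * D′ x) + sumBelow a (λ i → ecc′ (l + i) * D′ (l + i))
      + sumBelow b (λ i → ecc′ (l + a + i) * D′ (l + a + i))
      ≡⟨ cong₂ _+_ (cong₂ _+_ path-part (sumBelow-const a _ start-term)) (sumBelow-const b _ end-term) ⟩
    eccDistPath l + a * eccDepth l + b * eccDepth l
      + a * (suc l * (depthSum l + a' * 2 + b * suc l))
      + b * (suc l * (depthSum l + a * suc l + b' * 2)) ∎
    where
    open ≡-Reasoning
    start-term : ∀ i → i < a → ecc′ (l + i) * D′ (l + i) ≡ suc l * (depthSum l + a' * 2 + b * suc l)
    start-term i i<a = cong₂ _*_ (ecc-start (l + i) (proj₁ (start-index i<a)) (proj₂ (start-index i<a))) (D-start i i<a)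
    end-term : ∀ i → i < b → ecc′ (l + a + i) * D′ (l + a + i) ≡ suc l * (depthSum l + a * suc l + b' * 2)
    end-term i i<b = cong₂ _*_ (ecc-end (l + a + i) (end-index i) (+-monoʳ-< (l + a) i<b)) (D-end i i<b)

-- The part of EDS(P_l(a,b)) that depends only on l and on the number s + 2 of leaves.
EDS₀ : ℕ → ℕ → ℕ
EDS₀ m s = eccDistPath l + (2 + s) * eccDepth l + suc l * ((2 + s) * depthSum l + 2 * ((2 + s) * suc s))
  where
  l : ℕ
  l = suc m

EDS-Pl : ∀ m a' b' → EDS (Pl (suc m) (suc a') (suc b')) ≡ EDS₀ m (a' + b') + 2 * (suc (suc m) * m) * (suc a' * suc b')
EDS-Pl m a' b' = trans (Tree.EDS-regions m a' b') (regroup (eccDistPath (suc m)) (eccDepth (suc m)) (depthSum (suc m)) m a' b')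
  where
  regroup : ∀ S X T m a' b' →
    S + suc a' * X + suc b' * X
      + suc a' * (suc (suc m) * (T + a' * 2 + suc b' * suc (suc m)))
      + suc b' * (suc (suc m) * (T + suc a' * suc (suc m) + b' * 2))
    ≡ S + (2 + (a' + b')) * X + suc (suc m) * ((2 + (a' + b')) * T + 2 * ((2 + (a' + b')) * suc (a' + b')))
      + 2 * (suc (suc m) * m) * (suc a' * suc b')
  regroup = solve-∀

product-balance : ∀ x y → x < y → x * suc y < suc x * y
product-balance x y x<y = begin-strict
  x * suc y   ≡⟨ *-suc x y ⟩
  x + x * y   <⟨ +-monoˡ-< (x * y) x<y ⟩
  y + x * y   ∎
  where open ≤-Reasoning

EDS-shift : ∀ m a' b' → a' < b' →
            EDS (Pl (suc (suc m)) (suc a') (suc (suc b'))) < EDS (Pl (suc (suc m)) (suc (suc a')) (suc b'))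
EDS-shift m a' b' a'<b' = begin-strict
  EDS (Pl l (suc a') (suc (suc b')))               ≡⟨ EDS-Pl (suc m) a' (suc b') ⟩
  EDS₀ (suc m) (a' + suc b') + c * (suc a' * suc (suc b'))
    <⟨ +-monoʳ-< (EDS₀ (suc m) (a' + suc b')) (*-monoʳ-< c (product-balance (suc a') (suc b') (s≤s a'<b'))) ⟩
  EDS₀ (suc m) (a' + suc b') + c * (suc (suc a') * suc b')
    ≡⟨ cong (λ s → EDS₀ (suc m) s + c * (suc (suc a') * suc b')) (+-suc a' b') ⟩
  EDS₀ (suc m) (suc a' + b') + c * (suc (suc a') * suc b')
    ≡⟨ sym (EDS-Pl (suc m) (suc a') b') ⟩
  EDS (Pl l (suc (suc a')) (suc b'))               ∎
  where
  open ≤-Reasoning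
  l c : ℕ
  l = suc (suc m)
  c = 2 * (suc l * suc m)

leaves-unbalanced : ∀ t a' → suc (suc a') ≤ ⌊ t /2⌋ → Σ ℕ λ b' → a' < b' × t ≡ suc a' + suc (suc b')
leaves-unbalanced t a' c≤t/2 = suc (a' + r) , s≤s (m≤m+n a' r) , t≡
  where
  c r : ℕ
  c = suc (suc a')
  r = t ∸ (c + c)
  c+c≤t : c + c ≤ t
  c+c≤t = ≤-trans (+-mono-≤ c≤t/2 (≤-trans c≤t/2 (⌊n/2⌋≤⌈n/2⌉ t))) (≤-reflexive (⌊n/2⌋+⌈n/2⌉≡n t))
  t≡ : t ≡ suc a' + suc (suc (suc (a' + r)))
  t≡ = trans (sym (m+[n∸m]≡n c+c≤t)) (regroup a' r)
    where
    regroup : ∀ a' r → suc (suc a') + suc (suc a') + r ≡ suc a' + suc (suc (suc (a' + r)))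
    regroup = solve-∀

lemma2p4 : (l n : ℕ) → 2 ≤ l → l + 2 ≤ n →
    (a : ℕ) → 1 ≤ a → suc a ≤ ⌊ n ∸ l /2⌋ →
    EDS (Pl l a (n ∸ l ∸ a)) < EDS (Pl l (suc a) (n ∸ l ∸ suc a))
lemma2p4 (suc (suc m)) n (s≤s (s≤s z≤n)) _ (suc a') (s≤s z≤n) a<half with leaves-unbalanced (n ∸ suc (suc m)) a' a<half
... | b' , a'<b' , t≡ =
  subst₂ (λ b₁ b₂ → EDS (Pl (suc (suc m)) (suc a') b₁) < EDS (Pl (suc (suc m)) (suc (suc a')) b₂))
    (sym (trans (cong (_∸ suc a') t≡) (m+n∸m≡n (suc a') _)))
    (sym (trans (cong (_∸ suc (suc a')) (trans t≡ (+-suc (suc a') (suc b')))) (m+n∸m≡n (suc (suc a')) _)))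
    (EDS-shift m a' b' a'<b')
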